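{- Let $\mathcal S\subseteq\{ -1,0,1\}^3\setminus\{(0,0,0)\}$ be a finite set of steps. The following are equivalent: (i) for every family $(a_s)_{s\in\mathcal S}$ of non-negative integers with $\sum_{s\in\mathcal S}a_s s_x\ge 0$, one also has $\sum_{s\in\mathcal S}a_s s_y\ge 0$ and $\sum_{s\in\mathcal S}a_s s_z\ge 0$ (where $s=(s_x,s_y,s_z)$); (ii) both of the following hold: (a) $\mathcal S$ contains no step with second coordinate $-1$, or every step $(i,j,k)\in\mathcal S$ satisfies $j\ge i$; (b) $\mathcal S$ contains no step with third coordinate $-1$, or every step $(i,j,k)\in\mathcal S$ satisfies $k\ge i$.
   Context: A walk with steps in $\mathcal S$ (an $\mathcal S$-walk) starts at the origin; if $a_s$ denotes the number of occurrences of step $s$ in it, it ends in the octant $\mathbb N^3$ iff the three inequalities $\sum a_s s_x\ge0$ ("$x$-condition"), $\sum a_s s_y\ge0$ ("$y$-condition"), $\sum a_s s_z\ge0$ ("$z$-condition") hold. Statement (i) expresses that the $y$- and $z$-conditions can be ignored when defining $\mathcal S$-walks confined to the octant. -}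

module Defs where

open import Data.Integer using (ℤ; +_; -[1+_]; _+_; _*_; _≤_)
open import Data.Nat using (ℕ)
open import Data.List using (List; []; _∷_)
open import Data.Product using (_×_; _,_)
open import Relation.Binary.PropositionalEquality using (_≡_)
open import Relation.Nullary using (¬_)

data Coord : Set where
  m1 o p1 : Coord

val : Coord → ℤ
val m1 = -[1+ 0 ]
val o  = + 0
val p1 = + 1

Step : Set
Step = Coord × Coord × Coord

sx sy sz : Step → ℤ
sx (i , j , k) = val i
sy (i , j , k) = val j
sz (i , j , k) = val k

NonZeroStep : Step → Set
NonZeroStep s = ¬ (s ≡ (o , o , o))

-- Σ_{s ∈ S} a_s · c(s), for S given as a (duplicate-free) list.
wsum : (Step → ℕ) → (Step → ℤ) → List Step → ℤ
wsum a c []       = + 0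
wsum a c (s ∷ ss) = (+ (a s)) * c s + wsum a c ss

module Submission where

-- The two coordinates y and z play no interacting role, so the file proves
-- a one-coordinate criterion for arbitrary coordinate projections φ, γ of
-- the steps: "0 ≤ Σ a_s φ(s) always implies 0 ≤ Σ a_s γ(s)" (γ is
-- dominated by φ on S) holds iff no step has γ(s) = -1 or φ ≤ γ on all of S.
--  * (⇐) is monotonicity of the weighted sum wsum a c S in c: if γ is never
--    negative the γ-sum is non-negative, and if φ ≤ γ it bounds the φ-sum.
--  * (⇒) if some u ∈ S has γ(u) < φ(u) and some t ∈ S has γ(t) = -1, a
--    one- or two-step walk is a counterexample: either γ(u) = -1 ≤ 0 ≤ φ(u)
--    and the walk u works, or γ(u) = 0, φ(u) = 1 and the walk u t works.
--    Evaluating such walks as weights needs S duplicate-free.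
-- The theorem is the conjunction of the criterion for y and for z.

open import Defs
open import Data.Integer using (ℤ; +_; -[1+_]; _≤_)
open import Data.Nat using (ℕ)
open import Data.List using (List)
open import Data.List.Membership.Propositional using (_∈_)
open import Data.List.Relation.Unary.Unique.Propositional using (Unique)
open import Data.Product using (Σ; _×_; _,_)
open import Data.Sum using (_⊎_)
open import Relation.Binary.PropositionalEquality using (_≡_)
open import Relation.Nullary using (¬_)
open import Function.Bundles using (_⇔_)

import Data.Nat as ℕ
import Data.Integer as ℤ
open import Data.Integer using (-1ℤ)
import Data.Integer.Properties as ℤₚ
open import Data.Integer.Solver using (module +-*-Solver)
open import Data.List using ([]; _∷_)
open import Data.List.Membership.Propositional using (find)
open import Data.List.Relation.Unary.Any using (here; there)
open import Data.List.Relation.Unary.All using (all?; lookup)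
open import Data.List.Relation.Unary.All.Properties using (¬All⇒Any¬)
open import Data.List.Relation.Unary.AllPairs using (_∷_)
open import Data.Product using (proj₁; proj₂)
open import Data.Product.Properties using (≡-dec)
open import Data.Sum using (inj₁; inj₂)
open import Data.Bool using (if_then_else_)
open import Data.Empty using (⊥; ⊥-elim)
open import Function using (_∘_)
open import Function.Bundles using (mk⇔; module Equivalence)
open import Relation.Binary.Definitions using (DecidableEquality)
open import Relation.Binary.PropositionalEquality using (refl; sym; cong; cong₂; subst; subst₂; module ≡-Reasoning)
open import Relation.Nullary using (yes; no; does)

Dominates : List Step → (Step → ℤ) → (Step → ℤ) → Set
Dominates S f g = ∀ (a : Step → ℕ) → + 0 ≤ wsum a f S → + 0 ≤ wsum a g S

HasNegative : List Step → (Step → ℤ) → Set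
HasNegative S g = Σ Step λ s → (s ∈ S) × (g s ≡ -1ℤ)

Below : List Step → (Step → ℤ) → (Step → ℤ) → Set
Below S f g = ∀ s → s ∈ S → f s ≤ g s

wsum-mono : ∀ a (f g : Step → ℤ) S → Below S f g → wsum a f S ≤ wsum a g S
wsum-mono a f g [] _ = ℤ.+≤+ ℕ.z≤n
wsum-mono a f g (s ∷ S) f≤g =
  ℤₚ.+-mono-≤ (ℤₚ.*-monoˡ-≤-nonNeg (+ a s) (f≤g s (here refl)))
              (wsum-mono a f g S (λ x x∈S → f≤g x (there x∈S)))

wsum-nonneg : ∀ a (g : Step → ℤ) S → (∀ s → s ∈ S → + 0 ≤ g s) → + 0 ≤ wsum a g S
wsum-nonneg a g [] _ = ℤ.+≤+ ℕ.z≤n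
wsum-nonneg a g (s ∷ S) g≥0 =
  ℤₚ.+-mono-≤ {+ 0} {_} {+ 0}
    (subst (_≤ + a s ℤ.* g s) (ℤₚ.*-zeroʳ (+ a s))
           (ℤₚ.*-monoˡ-≤-nonNeg (+ a s) (g≥0 s (here refl))))
    (wsum-nonneg a g S (λ x x∈S → g≥0 x (there x∈S)))

wsum-vanishing : ∀ a (c : Step → ℤ) S → (∀ s → s ∈ S → a s ≡ 0) → wsum a c S ≡ + 0
wsum-vanishing a c [] _ = refl
wsum-vanishing a c (s ∷ S) a≡0 = begin
  + a s ℤ.* c s ℤ.+ wsum a c S ≡⟨ cong₂ (λ n r → + n ℤ.* c s ℤ.+ r) (a≡0 s (here refl))
                                        (wsum-vanishing a c S (λ x x∈S → a≡0 x (there x∈S))) ⟩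
  + 0 ℤ.* c s ℤ.+ + 0          ≡⟨ cong (ℤ._+ + 0) (ℤₚ.*-zeroˡ (c s)) ⟩
  + 0                          ∎
  where open ≡-Reasoning

wsum-+ : ∀ (a b : Step → ℕ) (c : Step → ℤ) S →
  wsum (λ s → a s ℕ.+ b s) c S ≡ wsum a c S ℤ.+ wsum b c S
wsum-+ a b c [] = refl
wsum-+ a b c (s ∷ S) = begin
  + (a s ℕ.+ b s) ℤ.* c s ℤ.+ wsum (λ x → a x ℕ.+ b x) c S
    ≡⟨ cong₂ (λ n r → n ℤ.* c s ℤ.+ r) (ℤₚ.pos-+ (a s) (b s)) (wsum-+ a b c S) ⟩
  (+ a s ℤ.+ + b s) ℤ.* c s ℤ.+ (wsum a c S ℤ.+ wsum b c S)
    ≡⟨ regroup (+ a s) (+ b s) (c s) (wsum a c S) (wsum b c S) ⟩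
  (+ a s ℤ.* c s ℤ.+ wsum a c S) ℤ.+ (+ b s ℤ.* c s ℤ.+ wsum b c S) ∎
  where
  open ≡-Reasoning
  open +-*-Solver
  regroup : ∀ x y z p q → (x ℤ.+ y) ℤ.* z ℤ.+ (p ℤ.+ q) ≡ (x ℤ.* z ℤ.+ p) ℤ.+ (y ℤ.* z ℤ.+ q)
  regroup = solve 5 (λ x y z p q → (x :+ y) :* z :+ (p :+ q) := (x :* z :+ p) :+ (y :* z :+ q)) refl

_≟ᶜ_ : DecidableEquality Coord
m1 ≟ᶜ m1 = yes refl
o  ≟ᶜ o  = yes refl
p1 ≟ᶜ p1 = yes refl
m1 ≟ᶜ o  = no λ ()
m1 ≟ᶜ p1 = no λ ()
o  ≟ᶜ m1 = no λ ()
o  ≟ᶜ p1 = no λ ()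
p1 ≟ᶜ m1 = no λ ()
p1 ≟ᶜ o  = no λ ()

_≟ˢ_ : DecidableEquality Step
_≟ˢ_ = ≡-dec _≟ᶜ_ (≡-dec _≟ᶜ_ _≟ᶜ_)

δ : Step → Step → ℕ
δ u s = if does (s ≟ˢ u) then 1 else 0

δ-self : ∀ u → δ u u ≡ 1
δ-self u with u ≟ˢ u
... | yes _  = refl
... | no u≢u = ⊥-elim (u≢u refl)

δ-other : ∀ u s → ¬ s ≡ u → δ u s ≡ 0
δ-other u s s≢u with s ≟ˢ u
... | yes s≡u = ⊥-elim (s≢u s≡u)
... | no _    = refl

wsum-δ : ∀ u (c : Step → ℤ) S → Unique S → u ∈ S → wsum (δ u) c S ≡ c u
wsum-δ u c (s ∷ S) (s∉S ∷ _) (here refl) = begin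
  + δ s s ℤ.* c s ℤ.+ wsum (δ s) c S ≡⟨ cong₂ (λ n r → + n ℤ.* c s ℤ.+ r) (δ-self s)
                                              (wsum-vanishing (δ s) c S absent) ⟩
  + 1 ℤ.* c s ℤ.+ + 0                ≡⟨ ℤₚ.+-identityʳ _ ⟩
  + 1 ℤ.* c s                        ≡⟨ ℤₚ.*-identityˡ (c s) ⟩
  c s                                ∎
  where
  open ≡-Reasoning
  absent : ∀ x → x ∈ S → δ s x ≡ 0
  absent x x∈S = δ-other s x (λ { refl → lookup s∉S x∈S refl })
wsum-δ u c (s ∷ S) (s∉S ∷ uniq) (there u∈S) = begin
  + δ u s ℤ.* c s ℤ.+ wsum (δ u) c S ≡⟨ cong₂ (λ n r → + n ℤ.* c s ℤ.+ r)
                                              (δ-other u s (λ { refl → lookup s∉S u∈S refl }))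
                                              (wsum-δ u c S uniq u∈S) ⟩
  + 0 ℤ.* c s ℤ.+ c u                ≡⟨ cong (ℤ._+ c u) (ℤₚ.*-zeroˡ (c s)) ⟩
  + 0 ℤ.+ c u                        ≡⟨ ℤₚ.+-identityˡ (c u) ⟩
  c u                                ∎
  where open ≡-Reasoning

wsum-δ₂ : ∀ u t (c : Step → ℤ) S → Unique S → u ∈ S → t ∈ S →
  wsum (λ s → δ u s ℕ.+ δ t s) c S ≡ c u ℤ.+ c t
wsum-δ₂ u t c S uniq u∈S t∈S = begin
  wsum (λ s → δ u s ℕ.+ δ t s) c S     ≡⟨ wsum-+ (δ u) (δ t) c S ⟩
  wsum (δ u) c S ℤ.+ wsum (δ t) c S    ≡⟨ cong₂ ℤ._+_ (wsum-δ u c S uniq u∈S) (wsum-δ t c S uniq t∈S) ⟩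
  c u ℤ.+ c t                          ∎
  where open ≡-Reasoning

one-step-witness : ∀ {f g : Step → ℤ} S → Unique S → ∀ {u} → u ∈ S →
  + 0 ≤ f u → g u ℤ.< + 0 → ¬ Dominates S f g
one-step-witness {f} {g} S uniq {u} u∈S 0≤fu gu<0 dom =
  ℤₚ.<⇒≱ gu<0 (subst (+ 0 ≤_) (wsum-δ u g S uniq u∈S)
                (dom (δ u) (subst (+ 0 ≤_) (sym (wsum-δ u f S uniq u∈S)) 0≤fu)))

two-step-witness : ∀ {f g : Step → ℤ} S → Unique S → ∀ {u t} → u ∈ S → t ∈ S →
  + 0 ≤ f u ℤ.+ f t → g u ℤ.+ g t ℤ.< + 0 → ¬ Dominates S f g
two-step-witness {f} {g} S uniq {u} {t} u∈S t∈S 0≤fut gut<0 dom =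
  ℤₚ.<⇒≱ gut<0 (subst (+ 0 ≤_) (wsum-δ₂ u t g S uniq u∈S t∈S)
                 (dom (λ s → δ u s ℕ.+ δ t s)
                      (subst (+ 0 ≤_) (sym (wsum-δ₂ u t f S uniq u∈S t∈S)) 0≤fut)))

val-nonneg : ∀ x → ¬ val x ≡ -1ℤ → + 0 ≤ val x
val-nonneg m1 x≢-1 = ⊥-elim (x≢-1 refl)
val-nonneg o  _    = ℤ.+≤+ ℕ.z≤n
val-nonneg p1 _    = ℤ.+≤+ ℕ.z≤n

val-gap : ∀ x y → ¬ val x ≤ val y →
  (val y ≡ -1ℤ × + 0 ≤ val x) ⊎ (val x ≡ + 1 × val y ≡ + 0)
val-gap o  m1 _   = inj₁ (refl , ℤ.+≤+ ℕ.z≤n)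
val-gap p1 m1 _   = inj₁ (refl , ℤ.+≤+ ℕ.z≤n)
val-gap p1 o  _   = inj₂ (refl , refl)
val-gap m1 m1 x≰y = ⊥-elim (x≰y ℤₚ.≤-refl)
val-gap m1 o  x≰y = ⊥-elim (x≰y ℤ.-≤+)
val-gap m1 p1 x≰y = ⊥-elim (x≰y ℤ.-≤+)
val-gap o  o  x≰y = ⊥-elim (x≰y ℤₚ.≤-refl)
val-gap o  p1 x≰y = ⊥-elim (x≰y (ℤ.+≤+ ℕ.z≤n))
val-gap p1 p1 x≰y = ⊥-elim (x≰y ℤₚ.≤-refl)

one+val-nonneg : ∀ x → + 0 ≤ + 1 ℤ.+ val x
one+val-nonneg m1 = ℤ.+≤+ ℕ.z≤n
one+val-nonneg o  = ℤ.+≤+ ℕ.z≤n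
one+val-nonneg p1 = ℤ.+≤+ ℕ.z≤n

module Criterion (φ γ : Step → Coord) where

  f g : Step → ℤ
  f = val ∘ φ
  g = val ∘ γ

  sufficient : ∀ S → ¬ HasNegative S g ⊎ Below S f g → Dominates S f g
  sufficient S (inj₁ no-neg) a _ =
    wsum-nonneg a g S (λ s s∈S → val-nonneg (γ s) (λ g≡-1 → no-neg (s , s∈S , g≡-1)))
  sufficient S (inj₂ f≤g) a 0≤f = ℤₚ.≤-trans 0≤f (wsum-mono a f g S f≤g)

  violation : ∀ S → Unique S → Dominates S f g →
    ∀ u → u ∈ S → ¬ f u ≤ g u → ∀ t → t ∈ S → g t ≡ -1ℤ → ⊥
  violation S uniq dom u u∈S fu≰gu t t∈S gt≡-1 with val-gap (φ u) (γ u) fu≰gu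
  ... | inj₁ (gu≡-1 , 0≤fu) =
    one-step-witness S uniq u∈S 0≤fu (subst (ℤ._< + 0) (sym gu≡-1) ℤ.-<+) dom
  ... | inj₂ (fu≡1 , gu≡0) =
    two-step-witness S uniq u∈S t∈S
      (subst (λ z → + 0 ≤ z ℤ.+ f t) (sym fu≡1) (one+val-nonneg (φ t)))
      (subst₂ (λ y z → y ℤ.+ z ℤ.< + 0) (sym gu≡0) (sym gt≡-1) ℤ.-<+)
      dom

  necessary : ∀ S → Unique S → Dominates S f g → ¬ HasNegative S g ⊎ Below S f g
  necessary S uniq dom with all? (λ s → f s ℤ.≤? g s) S
  ... | yes f≤g = inj₂ (λ s s∈S → lookup f≤g s∈S)
  ... | no  f≰g with find (¬All⇒Any¬ (λ s → f s ℤ.≤? g s) S f≰g)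
  ...   | u , u∈S , fu≰gu = inj₁ (λ (t , t∈S , gt≡-1) → violation S uniq dom u u∈S fu≰gu t t∈S gt≡-1)

  criterion : ∀ S → Unique S → Dominates S f g ⇔ (¬ HasNegative S g ⊎ Below S f g)
  criterion S uniq = mk⇔ (necessary S uniq) (sufficient S)

lemma2p3 : (S : List Step) → Unique S → (∀ s → s ∈ S → NonZeroStep s) →
    ((∀ (a : Step → ℕ) → + 0 ≤ wsum a sx S → (+ 0 ≤ wsum a sy S) × (+ 0 ≤ wsum a sz S))
    ⇔
    (((¬ (Σ Step λ s → (s ∈ S) × (sy s ≡ -[1+ 0 ]))) ⊎ (∀ s → s ∈ S → sx s ≤ sy s))
    × ((¬ (Σ Step λ s → (s ∈ S) × (sz s ≡ -[1+ 0 ]))) ⊎ (∀ s → s ∈ S → sx s ≤ sz s))))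
lemma2p3 S uniq _ = mk⇔
  (λ dom → to y-criterion (λ a → proj₁ ∘ dom a) , to z-criterion (λ a → proj₂ ∘ dom a))
  (λ (cy , cz) a 0≤x → from y-criterion cy a 0≤x , from z-criterion cz a 0≤x)
  where
  open Equivalence
  y-criterion : Dominates S sx sy ⇔ (¬ HasNegative S sy ⊎ Below S sx sy)
  y-criterion = Criterion.criterion proj₁ (proj₁ ∘ proj₂) S uniq
  z-criterion : Dominates S sx sz ⇔ (¬ HasNegative S sz ⊎ Below S sx sz)
  z-criterion = Criterion.criterion proj₁ (proj₂ ∘ proj₂) S uniq
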